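{- Let $G=(V,E,w)$ be a weighted hypergraph on $N$ vertices, all of positive degree, with maximum edge cardinality $\nabla$. Then each of the tensors $A$, $K$, $K^+$, $L$, $L^+$, $\mathcal{L}$, $\mathcal{L}^+$ of $G$ is weakly irreducible if and only if $G$ is connected.
   Context: A $k$-th order $n$-dimensional tensor $T$ is weakly irreducible if for every non-empty proper subset $J\subsetneq[n]$ there is a nonzero entry $T_{i_1,\ldots,i_k}$ with $i_1\in J$ and at least one of $i_2,\dots,i_k$ in $[n]\setminus J$. Hypergraphs: $G=(V,E,w)$, $V=\{v_1,\dots,v_N\}$, edges are subsets of $V$ of size $\ge2$, $w:E\to\mathbb{R}_{>0}$, $\deg v=\sum_{e\ni v}w(e)$, $\nabla=\max|e|$, $E_r=\{e:|e|=r\}$, $N(r,k)=(r-1)!\cdot\frac{1}{r!}\sum_{j=0}^r(-1)^j\binom{r}{j}(r-j)^k$. $G$ is connected if for any two vertices $v,w$ there are vertices $v=\hat v_1,\dots,\hat v_k=w$ and edges $\hat e_1,\dots,\hat e_{k-1}$ with $\{\hat v_i,\hat v_{i+1}\}\subseteq\hat e_i$. All tensors are $\nabla$-th order $N$-dimensional. $A_{i_1,\ldots,i_\nabla}=w(e)/N(r,\nabla)$ if $\{v_{i_1},\ldots,v_{i_\nabla}\}=e\in E_r$, else $0$. $K$ / $K^+$: diagonal $\deg v_i$, off-diagonal $\mp A_{i_1,\ldots,i_\nabla}$. $L$ / $L^+$: diagonal $1$, off-diagonal $\mp A_{i_1,\ldots,i_\nabla}\prod_{j\in\{i_1,\ldots,i_\nabla\}}(\deg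 v_j)^{ -1/\nabla}$ (product over distinct indices). $\mathcal L$ / $\mathcal L^+$: diagonal $1$, off-diagonal $\mp A_{i_1,\ldots,i_\nabla}/\deg v_{i_1}$ (minus sign for the unsigned-less tensors $K,L,\mathcal L$, plus for $K^+,L^+,\mathcal L^+$). -}

module Defs where

open import Level using (Level; _⊔_)
open import Algebra.Bundles using (CommutativeRing)
open import Relation.Binary.Structures using (IsStrictTotalOrder)
open import Data.Nat as ℕ using (ℕ; zero; suc; _∸_; _!; _≥_)
open import Data.Nat.Combinatorics using (_C_)
open import Data.Fin as Fin using (Fin; zero; suc)
open import Data.Fin.Properties using (any?; all?)
open import Data.Fin.Subset using (Subset; _∈_; _∉_; Nonempty; ∣_∣)
open import Data.Bool using (Bool; true; false; if_then_else_)
open import Data.Bool.Properties using () renaming (_≟_ to _≟ᵇ_)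
open import Data.Vec as Vec using (Vec; tabulate; lookup)
open import Data.Vec.Properties using (≡-dec)
open import Data.List as List using (List; []; _∷_)
open import Data.List.Relation.Unary.Unique.Propositional using (Unique)
open import Data.List.Relation.Unary.All using (All)
open import Data.List.Membership.Propositional using () renaming (_∈_ to _∈ˡ_)
open import Data.Product using (_×_; _,_; ∃; proj₁; proj₂)
open import Data.Maybe using (Maybe; just; nothing)
open import Data.Empty using (⊥)
open import Relation.Nullary using (¬_; yes; no; Dec)
open import Relation.Nullary.Decidable using (⌊_⌋)
open import Relation.Binary.PropositionalEquality using (_≡_)

pow : ∀ {c ℓ} (R : CommutativeRing c ℓ) → CommutativeRing.Carrier R → ℕ → CommutativeRing.Carrier R
pow R x zero    = CommutativeRing.1# R
pow R x (suc n) = CommutativeRing._*_ R x (pow R x n)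

record OrderedFieldWithRoots (c ℓ₁ ℓ₂ : Level) : Set (Level.suc (c ⊔ ℓ₁ ⊔ ℓ₂)) where
  field
    commutativeRing : CommutativeRing c ℓ₁
  open CommutativeRing commutativeRing public
  field
    _<_               : Carrier → Carrier → Set ℓ₂
    <-isStrictTotalOrder : IsStrictTotalOrder _≈_ _<_
    0<1               : 0# < 1#
    +-mono-<          : ∀ {x y} z → x < y → (x + z) < (y + z)
    *-pos             : ∀ {x y} → 0# < x → 0# < y → 0# < (x * y)
    _⁻¹               : Carrier → Carrier
    ⁻¹-inverse        : ∀ x → ¬ (x ≈ 0#) → (x * (x ⁻¹)) ≈ 1#
    root              : ℕ → Carrier → Carrier
    root-pos          : ∀ n x → 0# < x → 0# < root (suc n) x
    root-pow          : ∀ n x → 0# < x → pow commutativeRing (root (suc n) x) (suc n) ≈ x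

module WithField {c ℓ₁ ℓ₂} (F : OrderedFieldWithRoots c ℓ₁ ℓ₂) where
  open OrderedFieldWithRoots F hiding (zero)

  natF : ℕ → Carrier
  natF zero    = 0#
  natF (suc n) = 1# + natF n

  sumFin : ∀ {n} → (Fin n → Carrier) → Carrier
  sumFin {zero}  f = 0#
  sumFin {suc n} f = f zero + sumFin (λ i → f (suc i))

  prodFin : ∀ {n} → (Fin n → Carrier) → Carrier
  prodFin {zero}  f = 1#
  prodFin {suc n} f = f zero * prodFin (λ i → f (suc i))

  Ncoef : ℕ → ℕ → Carrier
  Ncoef r k = natF ((r ∸ 1) !) * ((natF (r !)) ⁻¹ *
              sumFin {suc r} (λ j → let j′ = Fin.toℕ j in
                 pow commutativeRing (- 1#) j′ * (natF (r C j′) * natF (ℕ._^_ (r ∸ j′) k))))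

  Tensor : ℕ → ℕ → Set c
  Tensor k N = (Fin k → Fin N) → Carrier

  Crossing : ∀ {k N} → Tensor k N → Subset N → Set ℓ₁
  Crossing {zero}  T J = Level.Lift _ ⊥
  Crossing {suc m} {N} T J =
    ∃ λ (i : Fin (suc m) → Fin N) →
      ¬ (T i ≈ 0#) × i zero ∈ J × ∃ λ (j : Fin m) → i (suc j) ∉ J

  WeaklyIrreducible : ∀ {k N} → Tensor k N → Set ℓ₁
  WeaklyIrreducible {k} {N} T =
    ∀ (J : Subset N) → Nonempty J → (∃ λ v → v ∉ J) → Crossing T J

  record Hypergraph (N : ℕ) : Set (c ⊔ ℓ₂) where
    field
      edges      : List (Subset N × Carrier)
      distinct   : Unique (List.map proj₁ edges)
      edge-size  : All (λ ew → ∣ proj₁ ew ∣ ≥ 2) edges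
      weight-pos : All (λ ew → 0# < proj₂ ew) edges

  module _ {N : ℕ} (G : Hypergraph N) where
    open Hypergraph G

    IsEdge : Subset N → Set (c ⊔ ℓ₁ ⊔ ℓ₂)
    IsEdge e = Level.Lift (ℓ₁ ⊔ ℓ₂) (∃ λ w → (e , w) ∈ˡ edges)

    deg : Fin N → Carrier
    deg v = List.foldr (λ ew acc → (if lookup (proj₁ ew) v then proj₂ ew else 0#) + acc) 0# edges

    ∇ : ℕ
    ∇ = List.foldr (λ ew acc → ℕ._⊔_ ∣ proj₁ ew ∣ acc) 0 edges

    weightOf : Subset N → Maybe Carrier
    weightOf e = go edges
      where
      go : List (Subset N × Carrier) → Maybe Carrier
      go [] = nothing
      go ((e′ , w) ∷ rest) with ≡-dec _≟ᵇ_ e e′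
      ... | yes _ = just w
      ... | no  _ = go rest

    image : ∀ {k} → (Fin k → Fin N) → Subset N
    image {k} i = tabulate (λ v → ⌊ any? (λ j → i j Fin.≟ v) ⌋)

    A : Tensor ∇ N
    A i with weightOf (image i)
    ... | just w  = w * (Ncoef ∣ image i ∣ ∇) ⁻¹
    ... | nothing = 0#

    mkTensor : ∀ {k} → (Fin N → Carrier) → Tensor k N → Tensor k N
    mkTensor {zero}  d off i = off i
    mkTensor {suc m} d off i with all? (λ j → i j Fin.≟ i zero)
    ... | yes _ = d (i zero)
    ... | no  _ = off i

    degFactor : (Fin ∇ → Fin N) → Carrier
    degFactor i = prodFin (λ v → if lookup (image i) v then (root ∇ (deg v)) ⁻¹ else 1#)

    divDegFirst : ∀ {k} → (Fin k → Fin N) → Carrier → Carrier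
    divDegFirst {zero}  i x = x
    divDegFirst {suc m} i x = x * (deg (i zero)) ⁻¹

    K K⁺ L L⁺ 𝓛 𝓛⁺ : Tensor ∇ N
    K  = mkTensor deg (λ i → - A i)
    K⁺ = mkTensor deg (λ i → A i)
    L  = mkTensor (λ _ → 1#) (λ i → - (A i * degFactor i))
    L⁺ = mkTensor (λ _ → 1#) (λ i → A i * degFactor i)
    𝓛  = mkTensor (λ _ → 1#) (λ i → - divDegFirst i (A i))
    𝓛⁺ = mkTensor (λ _ → 1#) (λ i → divDegFirst i (A i))

    data Walk : Fin N → Fin N → Set (c ⊔ ℓ₁ ⊔ ℓ₂) where
      here : ∀ {v} → Walk v v
      step : ∀ {v u w} (e : Subset N) → IsEdge e → v ∈ e → u ∈ e → Walk u w → Walk v w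

    Connected : Set (c ⊔ ℓ₁ ⊔ ℓ₂)
    Connected = ∀ v w → Walk v w

{-# OPTIONS --safe #-}
module Submission where

-- Weak irreducibility only asks, for each cut (J, complement of J), for a nonzero entry whose first index lies
-- in J and some other index outside J; such an entry has indices that are not all equal.  Off the diagonal,
-- each of the seven tensors is nonzero exactly where A is, and A is nonzero exactly at the index tuples
-- enumerating an edge, since weights are positive and N(r, ∇) = (r - 1)! S(∇, r) with S the Stirling numbers
-- of the second kind, positive for 1 ≤ r ≤ ∇; the other factors are powers of the positive degrees.  So a cut
-- is crossed by the tensor iff some edge meets both sides, and "every cut is crossed by an edge" is
-- connectivity.

open import Defs
open import Level using (_⊔_; lift)
open import Data.Nat as Nat using (ℕ; zero; suc; _∸_; _!; s≤s; z≤n)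
import Data.Nat.Properties as ℕₚ
open import Data.Nat.Combinatorics using (_C_; k>n⇒nCk≡0; nCk+nC[k+1]≡[n+1]C[k+1]; nC1≡n)
open import Data.Nat.Solver using (module +-*-Solver)
open import Data.Fin as Fin using (Fin; zero; suc)
open import Data.Fin.Properties using (any?; all?; toℕ-fromℕ<)
open import Data.Fin.Subset using (Subset; _∈_; _∉_; ∣_∣; _-_; _∪_; ⁅_⁆; inside; outside)
open import Data.Fin.Subset.Properties
  using (_∈?_; x∈p⇒∣p-x∣<∣p∣; x∈p∧x∉q⇒x∈p─q; p─q⊆p; x≢y⇒x∉⁅y⁆; p⊂q⇒∣p∣<∣q∣; ∣⊤∣≡n; ∈⊤;
         p⊆p∪q; q⊆p∪q; x∈⁅x⁆; x∈p∪q⁻; x∈⁅y⁆⇒x≡y)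
open import Data.Bool using (true; false; if_then_else_)
open import Data.Bool.Properties using () renaming (_≟_ to _≟ᵇ_)
open import Data.Vec as Vec using ([]; _∷_)
import Data.Vec.Properties as Vecₚ
open import Data.List as List using (List; []; _∷_; length)
open import Data.List.Properties using (length-map)
open import Data.List.Relation.Unary.Any using (here; there)
open import Data.List.Relation.Unary.All as All using (All; _∷_)
open import Data.List.Relation.Unary.AllPairs using (_∷_)
open import Data.List.Membership.Propositional using () renaming (_∈_ to _∈ˡ_)
open import Data.List.Membership.Propositional.Properties using (∈-map⁺; ∈-map⁻)
open import Data.Maybe using (just; nothing)
open import Data.Product using (_×_; _,_; proj₁; proj₂; ∃)
open import Data.Sum using (inj₁; inj₂)
open import Data.Empty using (⊥-elim)
open import Relation.Nullary using (¬_; yes; no; Dec)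
open import Relation.Nullary.Decidable using (⌊_⌋)
open import Relation.Binary.PropositionalEquality as ≡ using (_≡_; _≢_)
open import Relation.Binary.Structures using (IsStrictTotalOrder)
open import Algebra.Solver.Ring.AlmostCommutativeRing using (fromCommutativeRing; -raw-almostCommutative⟶)
import Algebra.Solver.Ring as RingSolver
import Algebra.Properties.Group as GroupProperties
import Algebra.Properties.AbelianGroup as AbelianGroupProperties
import Algebra.Properties.Ring as RingProperties
import Relation.Binary.Reasoning.Setoid as SetoidReasoning
open import Function.Bundles using (_⇔_; mk⇔; module Equivalence)
open import Function.Construct.Composition using (_⇔-∘_)
open import Function.Construct.Identity using (⇔-id)

[k+1]*[n+1]C[k+1]≡[n+1]*nCk : ∀ n k → suc k Nat.* (suc n C suc k) ≡ suc n Nat.* (n C k)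
[k+1]*[n+1]C[k+1]≡[n+1]*nCk zero zero = ≡.refl
[k+1]*[n+1]C[k+1]≡[n+1]*nCk zero (suc k) rewrite k>n⇒nCk≡0 {1} {suc (suc k)} (s≤s (s≤s z≤n))
                                             | k>n⇒nCk≡0 {0} {suc k} (s≤s z≤n) = ℕₚ.*-zeroʳ (suc (suc k))
[k+1]*[n+1]C[k+1]≡[n+1]*nCk (suc n) zero = ≡.trans (ℕₚ.*-identityˡ _) (≡.trans (nC1≡n (suc (suc n))) (≡.sym (ℕₚ.*-identityʳ _)))
[k+1]*[n+1]C[k+1]≡[n+1]*nCk (suc n) (suc k) = begin
    suc (suc k) * (suc (suc n) C suc (suc k))
  ≡⟨ ≡.cong (suc (suc k) *_) (≡.sym (nCk+nC[k+1]≡[n+1]C[k+1] (suc n) (suc k))) ⟩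
    suc (suc k) * (a + b)
  ≡⟨ solve 3 (λ k a b → (con 2 :+ k) :* (a :+ b) := ((con 1 :+ k) :* a :+ a) :+ (con 2 :+ k) :* b) ≡.refl k a b ⟩
    (suc k * a + a) + suc (suc k) * b
  ≡⟨ ≡.cong₂ (λ x y → (x + a) + y) ([k+1]*[n+1]C[k+1]≡[n+1]*nCk n k) ([k+1]*[n+1]C[k+1]≡[n+1]*nCk n (suc k)) ⟩
    (suc n * (n C k) + a) + suc n * (n C suc k)
  ≡⟨ solve 4 (λ n x y a → (con 1 :+ n) :* x :+ a :+ (con 1 :+ n) :* y := (con 1 :+ n) :* (x :+ y) :+ a) ≡.refl n (n C k) (n C suc k) a ⟩
    suc n * ((n C k) + (n C suc k)) + a
  ≡⟨ ≡.cong (λ x → suc n * x + a) (nCk+nC[k+1]≡[n+1]C[k+1] n k) ⟩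
    suc n * a + a
  ≡⟨ solve 2 (λ n a → (con 1 :+ n) :* a :+ a := (con 2 :+ n) :* a) ≡.refl n a ⟩
    suc (suc n) * a
  ∎
  where
  open ≡.≡-Reasoning
  open +-*-Solver
  open Nat using (_+_; _*_)
  a = suc n C suc k
  b = suc n C suc (suc k)

-- Absorption (j+1)·C(s+1,j+1) = (s+1)·C(s,j), combined with (s - j) + (j + 1) = s + 1.
C*pow-recurrence : ∀ s j k →
  (suc s C suc j) Nat.* ((s ∸ j) Nat.^ suc k) Nat.+ suc s Nat.* ((s C j) Nat.* ((s ∸ j) Nat.^ k))
    ≡ suc s Nat.* ((suc s C suc j) Nat.* ((s ∸ j) Nat.^ k))
C*pow-recurrence s j k with ℕₚ.≤-<-connex j s
... | inj₁ j≤s = begin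
    c₁ * (d * p) + suc s * (c₀ * p)
  ≡⟨ solve 5 (λ c₁ d p s₁ c₀ → c₁ :* (d :* p) :+ s₁ :* (c₀ :* p) := c₁ :* (d :* p) :+ (s₁ :* c₀) :* p) ≡.refl c₁ d p (suc s) c₀ ⟩
    c₁ * (d * p) + (suc s * c₀) * p
  ≡⟨ ≡.cong (λ x → c₁ * (d * p) + x * p) (≡.sym ([k+1]*[n+1]C[k+1]≡[n+1]*nCk s j)) ⟩
    c₁ * (d * p) + (suc j * c₁) * p
  ≡⟨ solve 4 (λ c₁ d p j → c₁ :* (d :* p) :+ ((con 1 :+ j) :* c₁) :* p := (con 1 :+ (d :+ j)) :* (c₁ :* p)) ≡.refl c₁ d p j ⟩
    suc (d + j) * (c₁ * p)
  ≡⟨ ≡.cong (λ x → suc x * (c₁ * p)) (ℕₚ.m∸n+n≡m j≤s) ⟩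
    suc s * (c₁ * p)
  ∎
  where
  open ≡.≡-Reasoning
  open +-*-Solver
  open Nat using (_+_; _*_)
  c₁ = suc s C suc j
  c₀ = s C j
  d = s ∸ j
  p = d Nat.^ k
... | inj₂ s<j rewrite k>n⇒nCk≡0 {s} {j} s<j | k>n⇒nCk≡0 {suc s} {suc j} (s≤s s<j) | ℕₚ.*-zeroʳ s = ≡.refl

stirling₂ : ℕ → ℕ → ℕ
stirling₂ zero    zero    = 1
stirling₂ zero    (suc r) = 0
stirling₂ (suc k) zero    = 0
stirling₂ (suc k) (suc r) = suc r Nat.* stirling₂ k (suc r) Nat.+ stirling₂ k r

r!*stirling₂-recurrence : ∀ k s →
  suc s ! Nat.* stirling₂ (suc k) (suc s)
    ≡ suc s Nat.* (suc s ! Nat.* stirling₂ k (suc s) Nat.+ s ! Nat.* stirling₂ k s)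
r!*stirling₂-recurrence k s =
  solve 4 (λ s f a b → (con 1 :+ s) :* f :* ((con 1 :+ s) :* a :+ b) := (con 1 :+ s) :* ((con 1 :+ s) :* f :* a :+ f :* b))
    ≡.refl s (s !) (stirling₂ k (suc s)) (stirling₂ k s)
  where open +-*-Solver

stirling₂-pos : ∀ k s → s Nat.≤ k → 0 Nat.< stirling₂ (suc k) (suc s)
stirling₂-pos zero    zero    _ = s≤s z≤n
stirling₂-pos (suc k) zero    _ =
  ℕₚ.<-≤-trans (stirling₂-pos k zero z≤n) (ℕₚ.≤-trans (ℕₚ.m≤m+n _ 0) (ℕₚ.m≤m+n _ (stirling₂ (suc k) 0)))
stirling₂-pos (suc k) (suc s) (s≤s s≤k) =
  ℕₚ.<-≤-trans (stirling₂-pos k s s≤k) (ℕₚ.m≤n+m _ (suc (suc s) Nat.* stirling₂ (suc k) (suc (suc s))))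

module OrderedFieldProperties {c ℓ₁ ℓ₂} (F : OrderedFieldWithRoots c ℓ₁ ℓ₂) where
  open OrderedFieldWithRoots F hiding (zero; _-_)
  open WithField F using (natF; sumFin; Ncoef)
  open IsStrictTotalOrder <-isStrictTotalOrder using (irrefl; <-respʳ-≈) renaming (trans to <-trans)
  open RingSolver _ (fromCommutativeRing commutativeRing)
    (-raw-almostCommutative⟶ (fromCommutativeRing commutativeRing)) (λ _ _ → nothing)
  open SetoidReasoning setoid
  open GroupProperties +-group using () renaming (⁻¹-involutive to -‿involutive)
  open AbelianGroupProperties +-abelianGroup using () renaming (⁻¹-∙-comm to -‿+-comm)
  open RingProperties ring using (-1*x≈-x; -‿distribˡ-*; -0#≈0#)

  1≉0 : ¬ 1# ≈ 0#
  1≉0 eq = irrefl (sym eq) 0<1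

  0<x⇒x≉0 : ∀ {x} → 0# < x → ¬ x ≈ 0#
  0<x⇒x≉0 p eq = irrefl (sym eq) p

  x≉0∧y≉0⇒x*y≉0 : ∀ {x y} → ¬ x ≈ 0# → ¬ y ≈ 0# → ¬ (x * y) ≈ 0#
  x≉0∧y≉0⇒x*y≉0 {x} {y} x≉0 y≉0 xy≈0 = 1≉0 (begin
    1#                      ≈⟨ sym (*-identityˡ 1#) ⟩
    1# * 1#                 ≈⟨ *-cong (sym (⁻¹-inverse x x≉0)) (sym (⁻¹-inverse y y≉0)) ⟩
    (x * x ⁻¹) * (y * y ⁻¹) ≈⟨ solve 4 (λ x x′ y y′ → (x :* x′) :* (y :* y′) := (x :* y) :* (x′ :* y′)) refl x (x ⁻¹) y (y ⁻¹) ⟩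
    (x * y) * (x ⁻¹ * y ⁻¹) ≈⟨ *-congʳ xy≈0 ⟩
    0# * (x ⁻¹ * y ⁻¹)      ≈⟨ zeroˡ _ ⟩
    0#                      ∎)

  x≉0⇒x⁻¹≉0 : ∀ {x} → ¬ x ≈ 0# → ¬ (x ⁻¹) ≈ 0#
  x≉0⇒x⁻¹≉0 {x} x≉0 x⁻¹≈0 = 1≉0 (trans (sym (⁻¹-inverse x x≉0)) (trans (*-congˡ x⁻¹≈0) (zeroʳ x)))

  x*y≉0⇔x≉0 : ∀ {x y} → ¬ y ≈ 0# → (¬ (x * y) ≈ 0#) ⇔ (¬ x ≈ 0#)
  x*y≉0⇔x≉0 {x} {y} y≉0 = mk⇔ (λ xy≉0 x≈0 → xy≉0 (trans (*-congʳ x≈0) (zeroˡ y))) (λ x≉0 → x≉0∧y≉0⇒x*y≉0 x≉0 y≉0)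

  -x≉0⇔x≉0 : ∀ {x} → (¬ (- x) ≈ 0#) ⇔ (¬ x ≈ 0#)
  -x≉0⇔x≉0 {x} = mk⇔ (λ -x≉0 x≈0 → -x≉0 (trans (-‿cong x≈0) -0#≈0#))
                      (λ x≉0 -x≈0 → x≉0 (trans (sym (-‿involutive x)) (trans (-‿cong -x≈0) -0#≈0#)))

  natF-+ : ∀ m n → natF (m Nat.+ n) ≈ natF m + natF n
  natF-+ zero    n = sym (+-identityˡ (natF n))
  natF-+ (suc m) n = trans (+-congˡ (natF-+ m n)) (sym (+-assoc 1# (natF m) (natF n)))

  natF-* : ∀ m n → natF (m Nat.* n) ≈ natF m * natF n
  natF-* zero    n = sym (zeroˡ (natF n))
  natF-* (suc m) n = begin
    natF (n Nat.+ m Nat.* n)      ≈⟨ natF-+ n (m Nat.* n) ⟩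
    natF n + natF (m Nat.* n)     ≈⟨ +-congˡ (natF-* m n) ⟩
    natF n + natF m * natF n      ≈⟨ +-congʳ (sym (*-identityˡ (natF n))) ⟩
    1# * natF n + natF m * natF n ≈⟨ sym (distribʳ (natF n) 1# (natF m)) ⟩
    (1# + natF m) * natF n        ∎

  0<natF : ∀ {m} → 0 Nat.< m → 0# < natF m
  0<natF {suc zero}    _ = <-respʳ-≈ (sym (+-identityʳ 1#)) 0<1
  0<natF {suc (suc m)} _ = <-trans (<-respʳ-≈ (sym (+-identityˡ _)) (0<natF {suc m} (s≤s z≤n))) (+-mono-< (natF (suc m)) 0<1)

  sumℕ : ℕ → (ℕ → Carrier) → Carrier
  sumℕ zero    f = 0#
  sumℕ (suc n) f = f 0 + sumℕ n (λ j → f (suc j))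

  sumFin≡sumℕ : ∀ n (f : ℕ → Carrier) → sumFin {n} (λ j → f (Fin.toℕ j)) ≡ sumℕ n f
  sumFin≡sumℕ zero    f = ≡.refl
  sumFin≡sumℕ (suc n) f = ≡.cong (f 0 +_) (sumFin≡sumℕ n (λ j → f (suc j)))

  sumℕ-cong : ∀ n {f g : ℕ → Carrier} → (∀ j → f j ≈ g j) → sumℕ n f ≈ sumℕ n g
  sumℕ-cong zero    f≈g = refl
  sumℕ-cong (suc n) f≈g = +-cong (f≈g 0) (sumℕ-cong n (λ j → f≈g (suc j)))

  sumℕ-+ : ∀ n (f g : ℕ → Carrier) → sumℕ n (λ j → f j + g j) ≈ sumℕ n f + sumℕ n g
  sumℕ-+ zero    f g = sym (+-identityˡ 0#)
  sumℕ-+ (suc n) f g = trans (+-congˡ (sumℕ-+ n (λ j → f (suc j)) (λ j → g (suc j))))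
    (solve 4 (λ a b c d → (a :+ b) :+ (c :+ d) := (a :+ c) :+ (b :+ d)) refl (f 0) (g 0) _ _)

  sumℕ-*ˡ : ∀ n a (f : ℕ → Carrier) → sumℕ n (λ j → a * f j) ≈ a * sumℕ n f
  sumℕ-*ˡ zero    a f = sym (zeroʳ a)
  sumℕ-*ˡ (suc n) a f = trans (+-congˡ (sumℕ-*ˡ n a (λ j → f (suc j)))) (sym (distribˡ a (f 0) _))

  sumℕ-neg : ∀ n (f : ℕ → Carrier) → sumℕ n (λ j → - f j) ≈ - sumℕ n f
  sumℕ-neg zero    f = sym -0#≈0#
  sumℕ-neg (suc n) f = trans (+-congˡ (sumℕ-neg n (λ j → f (suc j)))) (-‿+-comm (f 0) _)

  sumℕ-last : ∀ n (f : ℕ → Carrier) → sumℕ (suc n) f ≈ sumℕ n f + f n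
  sumℕ-last zero    f = trans (+-identityʳ (f 0)) (sym (+-identityˡ (f 0)))
  sumℕ-last (suc n) f = trans (+-congˡ (sumℕ-last n (λ j → f (suc j)))) (sym (+-assoc (f 0) _ _))

  sign : ℕ → Carrier
  sign j = pow commutativeRing (- 1#) j

  sign-suc : ∀ j → sign (suc j) ≈ - sign j
  sign-suc j = -1*x≈-x (sign j)

  alternatingTerm : ℕ → ℕ → ℕ → Carrier
  alternatingTerm r k j = sign j * (natF (r C j) * natF ((r ∸ j) Nat.^ k))

  alternatingSum : ℕ → ℕ → Carrier
  alternatingSum r k = sumℕ (suc r) (alternatingTerm r k)

  alternatingSum-0-0 : alternatingSum 0 0 ≈ natF 1
  alternatingSum-0-0 = trans (+-identityʳ _) (trans (*-identityˡ _) (sym (natF-* 1 1)))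

  alternatingSum-0-suc : ∀ k → alternatingSum 0 (suc k) ≈ 0#
  alternatingSum-0-suc k = trans (+-identityʳ _) (trans (*-identityˡ _) (zeroʳ _))

  -- Pascal's rule makes consecutive terms of Σⱼ (-1)ʲ (s+1 C j) telescope.
  alternatingSum-suc-0 : ∀ s → alternatingSum (suc s) 0 ≈ 0#
  alternatingSum-suc-0 s = begin
      alternatingSum (suc s) 0
    ≈⟨ sumℕ-cong (suc (suc s)) {alternatingTerm (suc s) 0} {β (suc s)} (λ j → *-congˡ (trans (*-congˡ (+-identityʳ 1#)) (*-identityʳ _))) ⟩
      sumℕ (suc (suc s)) (β (suc s))
    ≈⟨ +-congˡ (sumℕ-cong (suc s) β-suc) ⟩
      u + sumℕ (suc s) (λ j → - β s j + - γ j)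
    ≈⟨ +-congˡ (trans (sumℕ-+ (suc s) (λ j → - β s j) (λ j → - γ j)) (+-cong (sumℕ-neg (suc s) (β s)) (sumℕ-neg (suc s) γ))) ⟩
      u + (- sumℕ (suc s) (β s) + - sumℕ (suc s) γ)
    ≈⟨ +-congˡ (+-cong (-‿cong (+-congˡ sum-β-tail)) (-‿cong sum-γ)) ⟩
      u + (- (u + - sumℕ s γ) + - sumℕ s γ)
    ≈⟨ solve 3 (λ u y x → u :+ (y :+ x) := (u :+ x) :+ y) refl u (- (u + - sumℕ s γ)) (- sumℕ s γ) ⟩
      (u + - sumℕ s γ) + - (u + - sumℕ s γ)
    ≈⟨ -‿inverseʳ _ ⟩
      0# ∎
    where
    β : ℕ → ℕ → Carrier
    β r j = sign j * natF (r C j)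
    γ : ℕ → Carrier
    γ j = sign j * natF (s C suc j)
    u = β s 0
    β-suc : ∀ j → β (suc s) (suc j) ≈ - β s j + - γ j
    β-suc j = begin
        sign (suc j) * natF (suc s C suc j)
      ≈⟨ *-cong (sign-suc j) (reflexive (≡.cong natF (≡.sym (nCk+nC[k+1]≡[n+1]C[k+1] s j)))) ⟩
        - sign j * natF (s C j Nat.+ s C suc j)
      ≈⟨ *-congˡ (natF-+ (s C j) (s C suc j)) ⟩
        - sign j * (natF (s C j) + natF (s C suc j))
      ≈⟨ distribˡ (- sign j) _ _ ⟩
        - sign j * natF (s C j) + - sign j * natF (s C suc j)
      ≈⟨ +-cong (sym (-‿distribˡ-* _ _)) (sym (-‿distribˡ-* _ _)) ⟩
        - β s j + - γ j ∎
    sum-β-tail : sumℕ s (λ j → β s (suc j)) ≈ - sumℕ s γ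
    sum-β-tail = trans (sumℕ-cong s (λ j → trans (*-congʳ (sign-suc j)) (sym (-‿distribˡ-* _ _)))) (sumℕ-neg s γ)
    sum-γ : sumℕ (suc s) γ ≈ sumℕ s γ
    sum-γ = trans (sumℕ-last s γ)
      (trans (+-congˡ (trans (*-congˡ (reflexive (≡.cong natF (k>n⇒nCk≡0 {s} {suc s} (ℕₚ.n<1+n s))))) (zeroʳ _)))
             (+-identityʳ _))

  alternatingSum-recurrence : ∀ s k →
    alternatingSum (suc s) (suc k) ≈ natF (suc s) * (alternatingSum (suc s) k + alternatingSum s k)
  alternatingSum-recurrence s k = begin
      t (suc s) (suc k) 0 + sumℕ (suc s) (λ j → t (suc s) (suc k) (suc j))
    ≈⟨ +-cong head (sumℕ-cong (suc s) tail) ⟩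
      n * t (suc s) k 0 + sumℕ (suc s) (λ j → n * (t (suc s) k (suc j) + t s k j))
    ≈⟨ +-congˡ (trans (sumℕ-*ˡ (suc s) n (λ j → t (suc s) k (suc j) + t s k j)) (*-congˡ (sumℕ-+ (suc s) (λ j → t (suc s) k (suc j)) (t s k)))) ⟩
      n * t (suc s) k 0 + n * (sumℕ (suc s) (λ j → t (suc s) k (suc j)) + alternatingSum s k)
    ≈⟨ solve 4 (λ n a b c → n :* a :+ n :* (b :+ c) := n :* ((a :+ b) :+ c)) refl n _ _ _ ⟩
      n * (alternatingSum (suc s) k + alternatingSum s k) ∎
    where
    t = alternatingTerm
    n = natF (suc s)
    head : t (suc s) (suc k) 0 ≈ n * t (suc s) k 0
    head = trans (*-congˡ (*-congˡ (natF-* (suc s) (suc s Nat.^ k))))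
             (solve 4 (λ o a n p → o :* (a :* (n :* p)) := n :* (o :* (a :* p))) refl 1# (natF 1) n _)
    tail : ∀ j → t (suc s) (suc k) (suc j) ≈ n * (t (suc s) k (suc j) + t s k j)
    tail j = sym (begin
        n * ((- 1# * σ) * B + σ * C₀)
      ≈⟨ solve 5 (λ n mσ B σ C → n :* (mσ :* B :+ σ :* C) := mσ :* (n :* B) :+ σ :* (n :* C)) refl n (- 1# * σ) B σ C₀ ⟩
        (- 1# * σ) * (n * B) + σ * (n * C₀)
      ≈⟨ +-congʳ (*-congˡ (sym recurrence)) ⟩
        (- 1# * σ) * (A + n * C₀) + σ * (n * C₀)
      ≈⟨ solve 4 (λ mσ A X σ → mσ :* (A :+ X) :+ σ :* X := mσ :* A :+ (mσ :* X :+ σ :* X)) refl (- 1# * σ) A (n * C₀) σ ⟩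
        (- 1# * σ) * A + ((- 1# * σ) * (n * C₀) + σ * (n * C₀))
      ≈⟨ +-congˡ cancel ⟩
        (- 1# * σ) * A + 0#
      ≈⟨ +-identityʳ _ ⟩
        (- 1# * σ) * A ∎)
      where
      σ = sign j
      p = (s ∸ j) Nat.^ k
      c₁ = suc s C suc j
      c₀ = s C j
      A = natF c₁ * natF ((s ∸ j) Nat.^ suc k)
      B = natF c₁ * natF p
      C₀ = natF c₀ * natF p
      recurrence : A + n * C₀ ≈ n * B
      recurrence = begin
          A + n * C₀
        ≈⟨ +-cong (sym (natF-* c₁ ((s ∸ j) Nat.^ suc k))) (trans (*-congˡ (sym (natF-* c₀ p))) (sym (natF-* (suc s) (c₀ Nat.* p)))) ⟩
          natF (c₁ Nat.* ((s ∸ j) Nat.^ suc k)) + natF (suc s Nat.* (c₀ Nat.* p))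
        ≈⟨ sym (natF-+ (c₁ Nat.* ((s ∸ j) Nat.^ suc k)) (suc s Nat.* (c₀ Nat.* p))) ⟩
          natF (c₁ Nat.* ((s ∸ j) Nat.^ suc k) Nat.+ suc s Nat.* (c₀ Nat.* p))
        ≈⟨ reflexive (≡.cong natF (C*pow-recurrence s j k)) ⟩
          natF (suc s Nat.* (c₁ Nat.* p))
        ≈⟨ trans (natF-* (suc s) (c₁ Nat.* p)) (*-congˡ (natF-* c₁ p)) ⟩
          n * B ∎
      cancel : (- 1# * σ) * (n * C₀) + σ * (n * C₀) ≈ 0#
      cancel = trans (+-congʳ (trans (*-congʳ (-1*x≈-x σ)) (sym (-‿distribˡ-* σ _)))) (-‿inverseˡ _)

  alternatingSum≈r!*stirling₂ : ∀ k r → alternatingSum r k ≈ natF (r ! Nat.* stirling₂ k r)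
  alternatingSum≈r!*stirling₂ zero    zero    = alternatingSum-0-0
  alternatingSum≈r!*stirling₂ zero    (suc s) =
    trans (alternatingSum-suc-0 s) (reflexive (≡.cong natF (≡.sym (ℕₚ.*-zeroʳ (suc s !)))))
  alternatingSum≈r!*stirling₂ (suc k) zero    = alternatingSum-0-suc k
  alternatingSum≈r!*stirling₂ (suc k) (suc s) = begin
      alternatingSum (suc s) (suc k)
    ≈⟨ alternatingSum-recurrence s k ⟩
      natF (suc s) * (alternatingSum (suc s) k + alternatingSum s k)
    ≈⟨ *-congˡ (+-cong (alternatingSum≈r!*stirling₂ k (suc s)) (alternatingSum≈r!*stirling₂ k s)) ⟩
      natF (suc s) * (natF (suc s ! Nat.* a) + natF (s ! Nat.* b))
    ≈⟨ sym (trans (natF-* (suc s) (suc s ! Nat.* a Nat.+ s ! Nat.* b)) (*-congˡ (natF-+ (suc s ! Nat.* a) (s ! Nat.* b)))) ⟩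
      natF (suc s Nat.* (suc s ! Nat.* a Nat.+ s ! Nat.* b))
    ≈⟨ reflexive (≡.cong natF (≡.sym (r!*stirling₂-recurrence k s))) ⟩
      natF (suc s ! Nat.* stirling₂ (suc k) (suc s)) ∎
    where
    a = stirling₂ k (suc s)
    b = stirling₂ k s

  Ncoef≉0 : ∀ r k → 1 Nat.≤ r → r Nat.≤ k → ¬ Ncoef r k ≈ 0#
  Ncoef≉0 (suc s) (suc k) _ (s≤s s≤k) =
    x≉0∧y≉0⇒x*y≉0 (0<x⇒x≉0 (0<natF (ℕₚ.1≤n! s)))
      (x≉0∧y≉0⇒x*y≉0 (x≉0⇒x⁻¹≉0 (0<x⇒x≉0 (0<natF (ℕₚ.1≤n! (suc s)))))
        λ sum≈0 → 0<x⇒x≉0 (0<natF (ℕₚ.*-mono-≤ (ℕₚ.1≤n! (suc s)) (stirling₂-pos k s s≤k)))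
                   (trans (sym (alternatingSum≈r!*stirling₂ (suc k) (suc s)))
                     (trans (reflexive (≡.sym (sumFin≡sumℕ (suc (suc s)) (alternatingTerm (suc s) (suc k))))) sum≈0)))

elements : ∀ {n} → Subset n → List (Fin n)
elements []             = []
elements (inside ∷ s)  = zero ∷ List.map suc (elements s)
elements (outside ∷ s) = List.map suc (elements s)

∈-map-suc⁻ : ∀ {n} {v : Fin n} {xs} → suc v ∈ˡ List.map suc xs → v ∈ˡ xs
∈-map-suc⁻ suc-v∈ with ∈-map⁻ suc suc-v∈
... | _ , v∈ , ≡.refl = v∈

∈-elements⁺ : ∀ {n} {v : Fin n} (s : Subset n) → v ∈ s → v ∈ˡ elements s
∈-elements⁺ (inside ∷ s)  Vec.here      = here ≡.refl
∈-elements⁺ (inside ∷ s)  (Vec.there v∈s) = there (∈-map⁺ suc (∈-elements⁺ s v∈s))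
∈-elements⁺ (outside ∷ s) (Vec.there v∈s) = ∈-map⁺ suc (∈-elements⁺ s v∈s)

∈-elements⁻ : ∀ {n} {v : Fin n} (s : Subset n) → v ∈ˡ elements s → v ∈ s
∈-elements⁻ {v = zero}  (inside ∷ s)  _             = Vec.here
∈-elements⁻ {v = suc v} (inside ∷ s)  (there v∈)    = Vec.there (∈-elements⁻ s (∈-map-suc⁻ v∈))
∈-elements⁻ {v = zero}  (outside ∷ s) zero∈ with ∈-map⁻ suc zero∈
... | _ , _ , ()
∈-elements⁻ {v = suc v} (outside ∷ s) v∈            = Vec.there (∈-elements⁻ s (∈-map-suc⁻ v∈))

length-elements : ∀ {n} (s : Subset n) → length (elements s) ≡ ∣ s ∣
length-elements []            = ≡.refl
length-elements (inside ∷ s)  = ≡.cong suc (≡.trans (length-map suc (elements s)) (length-elements s))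
length-elements (outside ∷ s) = ≡.trans (length-map suc (elements s)) (length-elements s)

lookupOr : ∀ {a} {A : Set a} → A → List A → ℕ → A
lookupOr d []       m       = d
lookupOr d (x ∷ xs) zero    = x
lookupOr d (x ∷ xs) (suc m) = lookupOr d xs m

lookupOr-∈ : ∀ {a} {A : Set a} (d : A) xs m → lookupOr d xs m ∈ˡ d ∷ xs
lookupOr-∈ d []       m       = here ≡.refl
lookupOr-∈ d (x ∷ xs) zero    = there (here ≡.refl)
lookupOr-∈ d (x ∷ xs) (suc m) with lookupOr-∈ d xs m
... | here eq   = here eq
... | there x∈ = there (there x∈)

lookupOr-index : ∀ {a} {A : Set a} {x : A} d {xs} → x ∈ˡ xs → ∃ λ m → m Nat.< length xs × lookupOr d xs m ≡ x
lookupOr-index d (here ≡.refl) = 0 , s≤s z≤n , ≡.refl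
lookupOr-index d (there x∈) with lookupOr-index d x∈
... | m , m<len , eq = suc m , s≤s m<len , eq

∣e∣≤foldr-⊔ : ∀ {a n} {A : Set a} (l : List (Subset n × A)) {e w} → (e , w) ∈ˡ l →
              ∣ e ∣ Nat.≤ List.foldr (λ ew acc → ∣ proj₁ ew ∣ Nat.⊔ acc) 0 l
∣e∣≤foldr-⊔ (_ ∷ l) (here ≡.refl) = ℕₚ.m≤m⊔n _ _
∣e∣≤foldr-⊔ (_ ∷ l) (there e∈)    = ℕₚ.≤-trans (∣e∣≤foldr-⊔ l e∈) (ℕₚ.m≤n⊔m _ _)

module _ {c ℓ₁ ℓ₂} (F : OrderedFieldWithRoots c ℓ₁ ℓ₂) where
  open OrderedFieldWithRoots F hiding (zero; _-_)
  open WithField F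
  open OrderedFieldProperties F

  crossing⁻ : ∀ {k N} (T : Tensor k N) {J} → Crossing T J →
              ∃ λ i → ¬ T i ≈ 0# × ∃ λ p → ∃ λ q → i p ∈ J × i q ∉ J
  crossing⁻ {suc m} T (i , Ti≉0 , i₀∈J , j , iⱼ∉J) = i , Ti≉0 , zero , suc j , i₀∈J , iⱼ∉J

  crossing⁺ : ∀ {k N} (T : Tensor k N) {J} (i : Fin k → Fin N) p q → Fin.toℕ p ≡ 0 →
              i p ∈ J → i q ∉ J → ¬ T i ≈ 0# → Crossing T J
  crossing⁺ {suc m} T i zero zero    _ i₀∈J i₀∉J _    = ⊥-elim (i₀∉J i₀∈J)
  crossing⁺ {suc m} T i zero (suc j) _ i₀∈J iⱼ∉J Ti≉0 = i , Ti≉0 , i₀∈J , j , iⱼ∉J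

  prodFin≉0 : ∀ {n} {f : Fin n → Carrier} → (∀ v → ¬ f v ≈ 0#) → ¬ prodFin f ≈ 0#
  prodFin≉0 {zero}  f≉0 = 1≉0
  prodFin≉0 {suc n} f≉0 = x≉0∧y≉0⇒x*y≉0 (f≉0 zero) (prodFin≉0 (λ v → f≉0 (suc v)))

  -- Stated for an explicit record so that the induction can run over the list of edges.
  weightOf-sound : ∀ {N} (l : List (Subset N × Carrier)) {u s p} e {w} →
                   weightOf (record { edges = l ; distinct = u ; edge-size = s ; weight-pos = p }) e ≡ just w →
                   (e , w) ∈ˡ l
  weightOf-sound ((e′ , w′) ∷ l) {_ ∷ u} {_ ∷ s} {_ ∷ p} e with Vecₚ.≡-dec _≟ᵇ_ e e′
  ... | yes ≡.refl = λ { ≡.refl → here ≡.refl }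
  ... | no  _      = λ eq → there (weightOf-sound l {u} {s} {p} e eq)

  weightOf-complete : ∀ {N} (l : List (Subset N × Carrier)) {u s p} e {w} → (e , w) ∈ˡ l →
                      ∃ λ w′ → weightOf (record { edges = l ; distinct = u ; edge-size = s ; weight-pos = p }) e ≡ just w′
                             × 0# < w′
  weightOf-complete ((e′ , w′) ∷ l) {_ ∷ u} {_ ∷ s} {0<w′ ∷ p} e e∈ with Vecₚ.≡-dec _≟ᵇ_ e e′
  ... | yes ≡.refl = w′ , ≡.refl , 0<w′
  ... | no  e≢e′ with e∈
  ...   | here ≡.refl = ⊥-elim (e≢e′ ≡.refl)
  ...   | there e∈l   = weightOf-complete l {u} {s} {p} e e∈l

  module _ {N} (G : Hypergraph N) where
    open Hypergraph G

    ∣e∣≤∇ : ∀ {e w} → (e , w) ∈ˡ edges → ∣ e ∣ Nat.≤ ∇ G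
    ∣e∣≤∇ = ∣e∣≤foldr-⊔ edges

    CrossingEdge : Subset N → Set (c ⊔ ℓ₁ ⊔ ℓ₂)
    CrossingEdge J = ∃ λ e → IsEdge G e × ∃ λ y → ∃ λ x → y ∈ e × x ∈ e × y ∈ J × x ∉ J

    walk⇒crossingEdge : ∀ {J v w} → Walk G v w → v ∈ J → w ∉ J → CrossingEdge J
    walk⇒crossingEdge here v∈J w∉J = ⊥-elim (w∉J v∈J)
    walk⇒crossingEdge {J} (step {u = u} e e∈E v∈e u∈e walk) v∈J w∉J with u ∈? J
    ... | yes u∈J = walk⇒crossingEdge walk u∈J w∉J
    ... | no  u∉J = e , e∈E , _ , u , v∈e , u∈e , v∈J , u∉J

    walk-snoc : ∀ {v y x} e → IsEdge G e → y ∈ e → x ∈ e → Walk G v y → Walk G v x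
    walk-snoc e e∈E y∈e x∈e here                    = step e e∈E y∈e x∈e here
    walk-snoc e e∈E y∈e x∈e (step e′ e′∈E a b walk) = step e′ e′∈E a b (walk-snoc e e∈E y∈e x∈e walk)

    -- S, the set of vertices known to be reachable from v, gains a vertex along a crossing edge at each step.
    reach-all : (∀ S → (∃ λ v → v ∈ S) → (∃ λ w → w ∉ S) → CrossingEdge S) →
                ∀ v fuel S → N Nat.≤ fuel Nat.+ ∣ S ∣ → v ∈ S → (∀ x → x ∈ S → Walk G v x) → ∀ w → Walk G v w
    reach-all cross v fuel S N≤ v∈S walks w with w ∈? S
    ... | yes w∈S = walks w w∈S
    reach-all cross v zero S N≤ v∈S walks w | no w∉S =
      ⊥-elim (ℕₚ.<⇒≱ (ℕₚ.<-≤-trans (p⊂q⇒∣p∣<∣q∣ ((λ _ → ∈⊤) , w , ∈⊤ , w∉S)) (ℕₚ.≤-reflexive (∣⊤∣≡n N))) N≤)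
    reach-all cross v (suc fuel) S N≤ v∈S walks w | no w∉S with cross S (v , v∈S) (w , w∉S)
    ... | e , e∈E , y , x , y∈e , x∈e , y∈S , x∉S =
      reach-all cross v fuel (S ∪ ⁅ x ⁆) N≤′ (p⊆p∪q ⁅ x ⁆ v∈S) walks′ w
      where
      ∣S∣<∣S∪x∣ : ∣ S ∣ Nat.< ∣ S ∪ ⁅ x ⁆ ∣
      ∣S∣<∣S∪x∣ = p⊂q⇒∣p∣<∣q∣ (p⊆p∪q ⁅ x ⁆ , x , q⊆p∪q S ⁅ x ⁆ (x∈⁅x⁆ x) , x∉S)
      N≤′ : N Nat.≤ fuel Nat.+ ∣ S ∪ ⁅ x ⁆ ∣
      N≤′ = ℕₚ.≤-trans N≤ (ℕₚ.≤-trans (ℕₚ.≤-reflexive (≡.sym (ℕₚ.+-suc fuel ∣ S ∣))) (ℕₚ.+-monoʳ-≤ fuel ∣S∣<∣S∪x∣))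
      walks′ : ∀ z → z ∈ S ∪ ⁅ x ⁆ → Walk G v z
      walks′ z z∈ with x∈p∪q⁻ S ⁅ x ⁆ z∈
      ... | inj₁ z∈S = walks z z∈S
      ... | inj₂ z∈x rewrite x∈⁅y⁆⇒x≡y x z∈x = walk-snoc e e∈E y∈e x∈e (walks y y∈S)

    weaklyIrreducible⇔connected : ∀ {k} (T : Tensor k N) →
      (∀ {J} → Crossing T J → CrossingEdge J) → (∀ {J} → CrossingEdge J → Crossing T J) →
      WeaklyIrreducible T ⇔ Connected G
    weaklyIrreducible⇔connected T crossing⇒edge edge⇒crossing = mk⇔ wi⇒connected connected⇒wi
      where
      wi⇒connected : WeaklyIrreducible T → Connected G
      wi⇒connected wi v = reach-all (λ S v∈S w∉S → crossing⇒edge (wi S v∈S w∉S)) v N ⁅ v ⁆ (ℕₚ.m≤m+n N _) (x∈⁅x⁆ v)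
        (λ z z∈⁅v⁆ → ≡.subst (Walk G v) (≡.sym (x∈⁅y⁆⇒x≡y v z∈⁅v⁆)) here)
      connected⇒wi : Connected G → WeaklyIrreducible T
      connected⇒wi connected J (v , v∈J) (w , w∉J) = edge⇒crossing (walk⇒crossingEdge (connected v w) v∈J w∉J)

    image-∈ : ∀ {k} (i : Fin k → Fin N) p → i p ∈ image G i
    image-∈ i p = Vecₚ.lookup⇒[]= (i p) (image G i) (≡.trans (Vecₚ.lookup∘tabulate _ (i p)) (found (any? (λ j → i j Fin.≟ i p))))
      where
      found : (d : Dec (∃ λ j → i j ≡ i p)) → ⌊ d ⌋ ≡ true
      found (yes _)  = ≡.refl
      found (no ¬ip) = ⊥-elim (¬ip (p , ≡.refl))

    image-≡ : ∀ {k} (i : Fin k → Fin N) e → (∀ p → i p ∈ e) → (∀ v → v ∈ e → ∃ λ p → i p ≡ v) → image G i ≡ e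
    image-≡ i e i∈e onto = ≡.trans (Vecₚ.tabulate-cong pointwise) (Vecₚ.tabulate∘lookup e)
      where
      pointwise : ∀ v → ⌊ any? (λ j → i j Fin.≟ v) ⌋ ≡ Vec.lookup e v
      pointwise v with any? (λ j → i j Fin.≟ v) | Vec.lookup e v in eᵥ
      ... | yes _              | true  = ≡.refl
      ... | yes (j , ≡.refl)   | false with ≡.trans (≡.sym (Vecₚ.[]=⇒lookup (i∈e j))) eᵥ
      ...   | ()
      pointwise v | no v∉img | true  = ⊥-elim (v∉img (onto v (Vecₚ.lookup⇒[]= v e eᵥ)))
      pointwise v | no _     | false = ≡.refl

    record Indexing (k : ℕ) (e : Subset N) (y : Fin N) : Set where
      field
        index       : Fin k → Fin N
        first       : Fin k
        toℕ-first   : Fin.toℕ first ≡ 0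
        index-first : index first ≡ y
        index-onto  : ∀ v → v ∈ e → ∃ λ p → index p ≡ v
        image-index : image G index ≡ e

    -- Run through y, then the other elements of e, then repeat y.
    indexing : ∀ {k} e {y} → y ∈ e → ∣ e ∣ Nat.≤ k → Indexing k e y
    indexing {k} e {y} y∈e ∣e∣≤k = record
      { index = index ; first = first ; toℕ-first = toℕ-first ; index-first = ≡.cong (lookupOr y ys) toℕ-first
      ; index-onto = index-onto ; image-index = image-≡ index e index∈e index-onto }
      where
      ys = y ∷ elements (e - y)
      length≤k : length ys Nat.≤ k
      length≤k = ℕₚ.≤-trans (s≤s (ℕₚ.≤-reflexive (length-elements (e - y)))) (ℕₚ.≤-trans (x∈p⇒∣p-x∣<∣p∣ y∈e) ∣e∣≤k)
      index : Fin k → Fin N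
      index p = lookupOr y ys (Fin.toℕ p)
      first : Fin k
      first = Fin.fromℕ< (ℕₚ.<-≤-trans (s≤s z≤n) length≤k)
      toℕ-first : Fin.toℕ first ≡ 0
      toℕ-first = toℕ-fromℕ< _
      ys⊆e : ∀ {u} → u ∈ˡ y ∷ ys → u ∈ e
      ys⊆e (here ≡.refl)         = y∈e
      ys⊆e (there (here ≡.refl)) = y∈e
      ys⊆e (there (there u∈))    = p─q⊆p e ⁅ y ⁆ (∈-elements⁻ (e - y) u∈)
      index∈e : ∀ p → index p ∈ e
      index∈e p = ys⊆e (lookupOr-∈ y ys (Fin.toℕ p))
      index-of : ∀ {v} → v ∈ˡ ys → ∃ λ p → index p ≡ v
      index-of v∈ with lookupOr-index y v∈
      ... | m , m<len , eq = Fin.fromℕ< m<k , ≡.trans (≡.cong (lookupOr y ys) (toℕ-fromℕ< m<k)) eq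
        where m<k = ℕₚ.<-≤-trans m<len length≤k
      index-onto : ∀ v → v ∈ e → ∃ λ p → index p ≡ v
      index-onto v v∈e with v Fin.≟ y
      ... | yes ≡.refl = index-of (here ≡.refl)
      ... | no  v≢y    = index-of (there (∈-elements⁺ (e - y) (x∈p∧x∉q⇒x∈p─q v∈e (x≢y⇒x∉⁅y⁆ v≢y))))

    A≉0⇒edge : ∀ i → ¬ A G i ≈ 0# → ∃ λ w → (image G i , w) ∈ˡ edges
    A≉0⇒edge i Aᵢ≉0 with weightOf G (image G i) in eq
    ... | just w  = w , weightOf-sound edges {distinct} {edge-size} {weight-pos} (image G i) eq
    ... | nothing = ⊥-elim (Aᵢ≉0 refl)

    edge⇒A≉0 : ∀ i {w} → (image G i , w) ∈ˡ edges → ¬ A G i ≈ 0#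
    edge⇒A≉0 i e∈ with weightOf G (image G i) | weightOf-complete edges {distinct} {edge-size} {weight-pos} (image G i) e∈
    ... | just w | _ , ≡.refl , 0<w =
      x≉0∧y≉0⇒x*y≉0 (0<x⇒x≉0 0<w) (x≉0⇒x⁻¹≉0 (Ncoef≉0 _ _ (ℕₚ.≤-trans (s≤s z≤n) (All.lookup edge-size e∈)) (∣e∣≤∇ e∈)))

    A≉0⇒∇≡suc : ∀ i → ¬ A G i ≈ 0# → ∃ λ m → ∇ G ≡ suc m
    A≉0⇒∇≡suc i Aᵢ≉0 with ℕₚ.m≤n⇒∃[o]m+o≡n 1≤∇
      where
      e∈ = proj₂ (A≉0⇒edge i Aᵢ≉0)
      1≤∇ = ℕₚ.≤-trans (ℕₚ.≤-trans (s≤s z≤n) (All.lookup edge-size e∈)) (∣e∣≤∇ e∈)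
    ... | m , 1+m≡∇ = m , ≡.sym 1+m≡∇

    SameOffDiagonalSupportAsA : Tensor (∇ G) N → Set ℓ₁
    SameOffDiagonalSupportAsA T = ∀ i p q → i p ≢ i q → (¬ T i ≈ 0#) ⇔ (¬ A G i ≈ 0#)

    sameSupportAsA⇒weaklyIrreducible⇔connected : ∀ {T} → SameOffDiagonalSupportAsA T → WeaklyIrreducible T ⇔ Connected G
    sameSupportAsA⇒weaklyIrreducible⇔connected {T} support = weaklyIrreducible⇔connected T crossing⇒edge edge⇒crossing
      where
      crossing⇒edge : ∀ {J} → Crossing T J → CrossingEdge J
      crossing⇒edge {J} cross with crossing⁻ T cross
      ... | i , Tᵢ≉0 , p , q , ip∈J , iq∉J with A≉0⇒edge i (Equivalence.to (support i p q ip≢iq) Tᵢ≉0)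
        where ip≢iq = λ ip≡iq → iq∉J (≡.subst (_∈ J) ip≡iq ip∈J)
      ... | w , e∈ = image G i , lift (w , e∈) , i p , i q , image-∈ i p , image-∈ i q , ip∈J , iq∉J
      edge⇒crossing : ∀ {J} → CrossingEdge J → Crossing T J
      edge⇒crossing {J} (e , lift (w , e∈) , y , x , y∈e , x∈e , y∈J , x∉J) with index-onto x x∈e
        where open Indexing (indexing e y∈e (∣e∣≤∇ e∈))
      ... | q , index-q≡x =
        crossing⁺ T index first q toℕ-first (≡.subst (_∈ J) (≡.sym index-first) y∈J) (≡.subst (_∉ J) (≡.sym index-q≡x) x∉J)
          (Equivalence.from (support index first q index-first≢index-q)
            (edge⇒A≉0 index (≡.subst (λ e′ → (e′ , w) ∈ˡ edges) (≡.sym image-index) e∈)))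
        where
        open Indexing (indexing e y∈e (∣e∣≤∇ e∈))
        index-first≢index-q : index first ≢ index q
        index-first≢index-q eq = x∉J (≡.subst (_∈ J) (≡.trans (≡.sym index-first) (≡.trans eq index-q≡x)) y∈J)

    mkTensor-off-diagonal : ∀ {k} d (off : Tensor k N) (i : Fin k → Fin N) p q → i p ≢ i q → mkTensor G d off i ≡ off i
    mkTensor-off-diagonal {zero}  d off i p q ip≢iq = ≡.refl
    mkTensor-off-diagonal {suc m} d off i p q ip≢iq with all? (λ j → i j Fin.≟ i zero)
    ... | yes constant = ⊥-elim (ip≢iq (≡.trans (constant p) (≡.sym (constant q))))
    ... | no  _        = ≡.refl

    mkTensor-support : ∀ d (off : Tensor (∇ G) N) → (∀ i → (¬ off i ≈ 0#) ⇔ (¬ A G i ≈ 0#)) →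
                       SameOffDiagonalSupportAsA (mkTensor G d off)
    mkTensor-support d off off≉0⇔A≉0 i p q ip≢iq
      rewrite mkTensor-off-diagonal d off i p q ip≢iq = off≉0⇔A≉0 i

    support-A : SameOffDiagonalSupportAsA (A G)
    support-A i _ _ _ = ⇔-id _

    support-K : SameOffDiagonalSupportAsA (K G)
    support-K = mkTensor-support (deg G) _ (λ i → -x≉0⇔x≉0)

    support-K⁺ : SameOffDiagonalSupportAsA (K⁺ G)
    support-K⁺ = mkTensor-support (deg G) _ (λ i → ⇔-id _)

    module _ (0<deg : ∀ v → 0# < deg G v) where

      degFactor≉0 : ∀ i → ¬ A G i ≈ 0# → ¬ degFactor G i ≈ 0#
      degFactor≉0 i Aᵢ≉0 with A≉0⇒∇≡suc i Aᵢ≉0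
      ... | m , ∇≡1+m = prodFin≉0 λ v → factor≉0 v (Vec.lookup (image G i) v)
        where
        factor≉0 : ∀ v b → ¬ (if b then root (∇ G) (deg G v) ⁻¹ else 1#) ≈ 0#
        factor≉0 v true  = x≉0⇒x⁻¹≉0 (0<x⇒x≉0 (≡.subst (λ n → 0# < root n (deg G v)) (≡.sym ∇≡1+m) (root-pos m (deg G v) (0<deg v))))
        factor≉0 v false = 1≉0

      divDegFirst≉0⇔x≉0 : ∀ {k} (i : Fin k → Fin N) {x} → (¬ divDegFirst G i x ≈ 0#) ⇔ (¬ x ≈ 0#)
      divDegFirst≉0⇔x≉0 {zero}  i = ⇔-id _
      divDegFirst≉0⇔x≉0 {suc m} i = x*y≉0⇔x≉0 (x≉0⇒x⁻¹≉0 (0<x⇒x≉0 (0<deg (i zero))))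

      A*degFactor≉0⇔A≉0 : ∀ i → (¬ (A G i * degFactor G i) ≈ 0#) ⇔ (¬ A G i ≈ 0#)
      A*degFactor≉0⇔A≉0 i = mk⇔ (λ A*d≉0 Aᵢ≈0 → A*d≉0 (trans (*-congʳ Aᵢ≈0) (zeroˡ _)))
                                  (λ Aᵢ≉0 → x≉0∧y≉0⇒x*y≉0 Aᵢ≉0 (degFactor≉0 i Aᵢ≉0))

      support-L : SameOffDiagonalSupportAsA (L G)
      support-L = mkTensor-support _ _ (λ i → A*degFactor≉0⇔A≉0 i ⇔-∘ -x≉0⇔x≉0)

      support-L⁺ : SameOffDiagonalSupportAsA (L⁺ G)
      support-L⁺ = mkTensor-support _ _ A*degFactor≉0⇔A≉0

      support-𝓛 : SameOffDiagonalSupportAsA (𝓛 G)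
      support-𝓛 = mkTensor-support _ _ (λ i → divDegFirst≉0⇔x≉0 i ⇔-∘ -x≉0⇔x≉0)

      support-𝓛⁺ : SameOffDiagonalSupportAsA (𝓛⁺ G)
      support-𝓛⁺ = mkTensor-support _ _ (λ i → divDegFirst≉0⇔x≉0 i)

theorem3p8 : ∀ {c ℓ₁ ℓ₂} (F : OrderedFieldWithRoots c ℓ₁ ℓ₂) (N : ℕ)
                 (G : WithField.Hypergraph F N) →
               let open OrderedFieldWithRoots F
                   open WithField F
               in (∀ v → 0# < deg G v) →
                  (WeaklyIrreducible (A G) ⇔ Connected G)
                  × (WeaklyIrreducible (K G) ⇔ Connected G)
                  × (WeaklyIrreducible (K⁺ G) ⇔ Connected G)
                  × (WeaklyIrreducible (L G) ⇔ Connected G)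
                  × (WeaklyIrreducible (L⁺ G) ⇔ Connected G)
                  × (WeaklyIrreducible (𝓛 G) ⇔ Connected G)
                  × (WeaklyIrreducible (𝓛⁺ G) ⇔ Connected G)
theorem3p8 F N G 0<deg =
    sameSupportAsA⇒weaklyIrreducible⇔connected F G (support-A F G)
  , sameSupportAsA⇒weaklyIrreducible⇔connected F G (support-K F G)
  , sameSupportAsA⇒weaklyIrreducible⇔connected F G (support-K⁺ F G)
  , sameSupportAsA⇒weaklyIrreducible⇔connected F G (support-L F G 0<deg)
  , sameSupportAsA⇒weaklyIrreducible⇔connected F G (support-L⁺ F G 0<deg)
  , sameSupportAsA⇒weaklyIrreducible⇔connected F G (support-𝓛 F G 0<deg)
  , sameSupportAsA⇒weaklyIrreducible⇔connected F G (support-𝓛⁺ F G 0<deg)
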